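{- For every $n\geq 3$ there exist two distinct $S_{n-1,n-1}$-free subgraphs $G_n$ and $G_n'$ of $Q_n$, each having exactly $2^{n-3}\times(4n-3)$ edges, such that no vertex of $Q_n$ has degree $n$ in both $G_n$ and $G_n'$.
   Context: The $n$-dimensional hypercube $Q_n$ is the graph with vertex set $\{0,1\}^n$ in which two vertices are adjacent if and only if they differ in exactly one coordinate. Subgraphs of $Q_n$ are taken on the full vertex set $\{0,1\}^n$ (spanning subgraphs). A double star $S_{k,l}$ is the graph obtained by taking an edge $uv$ and joining $u$ to $k$ further vertices and $v$ to $l$ further vertices, all these $k+l$ vertices distinct from each other and from $u,v$. A graph is $H$-free if it contains no subgraph isomorphic to $H$. -}

module Defs where

open import Data.Bool using (Bool; true; false; not; _∧_; if_then_else_)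
open import Data.Nat using (ℕ; zero; suc; _+_)
open import Data.Fin using (Fin)
open import Data.Vec using (Vec; []; _∷_; lookup; _[_]%=_)
open import Data.List using (List; []; _∷_; map; _++_; concatMap; allFin)
open import Data.Nat.ListAction using (sum)
open import Data.Product using (Σ; ∃; _×_; _,_)
open import Relation.Binary.PropositionalEquality using (_≡_; _≢_)
open import Relation.Nullary using (¬_)
open import Function.Definitions using (Injective)

V : ℕ → Set
V n = Vec Bool n

flipAt : ∀ {n} → V n → Fin n → V n
flipAt x i = x [ i ]%= not

allV : (n : ℕ) → List (V n)
allV zero = [] ∷ []
allV (suc n) = map (false ∷_) (allV n) ++ map (true ∷_) (allV n)

-- A spanning subgraph of Q_n: for each vertex x and direction i it says
-- whether the Q_n-edge {x , flipAt x i} belongs to the subgraph.  Both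
-- endpoints must agree, so this is exactly a subset of E(Q_n).
record Subgraph (n : ℕ) : Set where
  field
    edge : V n → Fin n → Bool
    sym  : ∀ x i → edge (flipAt x i) i ≡ edge x i
open Subgraph public

Adj : ∀ {n} → Subgraph n → V n → V n → Set
Adj G x y = ∃ λ i → (y ≡ flipAt x i) × (edge G x i ≡ true)

b2n : Bool → ℕ
b2n true = 1
b2n false = 0

deg : ∀ {n} → Subgraph n → V n → ℕ
deg {n} G x = sum (map (λ i → b2n (edge G x i)) (allFin n))

-- number of edges of G: each edge {x , flipAt x i} is counted once, from
-- its endpoint having coordinate i equal to 0 (false)
edgeCount : ∀ {n} → Subgraph n → ℕ
edgeCount {n} G =
  sum (concatMap (λ x → map (λ i → b2n (not (lookup x i) ∧ edge G x i)) (allFin n)) (allV n))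

record DoubleStarIn {n} (G : Subgraph n) (k l : ℕ) : Set where
  field
    u v : V n
    a : Fin k → V n
    b : Fin l → V n
    uv  : Adj G u v
    ua  : ∀ p → Adj G u (a p)
    vb  : ∀ q → Adj G v (b q)
    a-inj : Injective _≡_ _≡_ a
    b-inj : Injective _≡_ _≡_ b
    u≢v : u ≢ v
    a≢u : ∀ p → a p ≢ u
    a≢v : ∀ p → a p ≢ v
    b≢u : ∀ q → b q ≢ u
    b≢v : ∀ q → b q ≢ v
    a≢b : ∀ p q → a p ≢ b q

DoubleStarFree : ∀ {n} → Subgraph n → ℕ → ℕ → Set
DoubleStarFree G k l = ¬ DoubleStarIn G k l

Distinct : ∀ {n} → Subgraph n → Subgraph n → Set
Distinct {n} G G' = ∃ λ (x : V n) → ∃ λ (i : Fin n) → edge G x i ≢ edge G' x i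

module Submission where

open import Defs
open import Data.Nat using (ℕ; _≤_; _+_; _*_; _∸_; _^_)
open import Data.Product using (Σ; _×_)
open import Relation.Binary.PropositionalEquality using (_≡_)
open import Relation.Nullary using (¬_)

open import Data.Nat using (zero; suc; pred; z≤n; s≤s)
open import Data.Nat.Properties using (+-assoc; +-comm; +-identityʳ; n<1+n; m≤n⇒m≤1+n; <-irrefl; m+n∸m≡n)
open import Data.Nat.ListAction using (sum)
open import Data.Nat.ListAction.Properties using (sum-++)
open import Data.Nat.Tactic.RingSolver using (solve-∀)
open import Data.Bool using (Bool; true; false; not; _∧_; _∨_; _xor_)
open import Data.Bool.Properties using (not-involutive; not-¬; not-distribˡ-xor; not-distribʳ-xor)
  renaming (_≟_ to _≟ᵇ_)
open import Data.Fin using (Fin; zero; suc; punchOut) renaming (_≟_ to _≟ᶠ_)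
open import Data.Fin.Properties using (any?; pigeonhole; punchOut-injective; ¬∀⟶∃¬)
  renaming (<-irrefl to <-irreflᶠ)
open import Data.Vec using ([]; _∷_; lookup; replicate)
open import Data.Vec.Properties using (updateAt-updateAt; updateAt-id-local)
import Data.Vec.Functional as Vector
open import Data.List using (List; []; _∷_; map; _++_; concatMap; allFin; length)
open import Data.List.Properties using (map-++; map-∘; map-cong; map-tabulate; length-map; length-++; length-tabulate)
open import Data.List.Relation.Unary.All as All using (All; []; _∷_)
open import Data.List.Relation.Unary.All.Properties using (map⁻)
open import Data.List.Membership.Propositional.Properties using (∈-allFin)
open import Data.Product using (_,_; proj₁; proj₂; ∃)
open import Data.Empty using (⊥; ⊥-elim)
open import Function using (_∘_)
open import Function.Definitions using (Injective)
open import Relation.Nullary using (yes; no)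
open import Relation.Binary.PropositionalEquality as ≡ using (refl; trans; cong; cong₂; subst; _≢_; module ≡-Reasoning)

-- A copy
-- of S_{n-1,n-1} needs two adjacent full vertices, so a subgraph whose full
-- vertices are pairwise non-adjacent in Q_n is S_{n-1,n-1}-free.  Starting
-- from two such subgraphs of Q_3 with 9 edges each and disjoint sets of full
-- vertices, put G_{n+1} = G_n ⊕ G_n' and G_{n+1}' = G_n' ⊕ G_n, where A ⊕ B
-- places A on the facet x₀ = 0, B on the facet x₀ = 1, and adds the perfect
-- matching in direction 0.  The full vertices of A ⊕ B are those of A and B on
-- their facets; as those of A and B are disjoint, both properties survive, and
-- the edge count obeys e_{n+1} = 2^n + 2 e_n.

Full : ∀ {n} → Subgraph n → V n → Set
Full {n} G x = ∀ (i : Fin n) → edge G x i ≡ true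

FullIndependent : ∀ {n} → Subgraph n → Set
FullIndependent G = ∀ x i → Full G x → Full G (flipAt x i) → ⊥

FullDisjoint : ∀ {n} → Subgraph n → Subgraph n → Set
FullDisjoint G G' = ∀ x → Full G x → Full G' x → ⊥

flipAt-involutive : ∀ {n} (x : V n) i → flipAt (flipAt x i) i ≡ x
flipAt-involutive x i = trans (updateAt-updateAt i x) (updateAt-id-local i x (not-involutive _))

Adj-sym : ∀ {n} (G : Subgraph n) {u v} → Adj G u v → Adj G v u
Adj-sym G {u} (i , refl , uv) = i , ≡.sym (flipAt-involutive u i) , trans (Subgraph.sym G u i) uv

Full⇒Distinct : ∀ {n} (G G' : Subgraph n) {x} → Full G x → ¬ Full G' x → Distinct G G'
Full⇒Distinct {n} G G' {x} full ¬full' with ¬∀⟶∃¬ n _ (λ i → edge G' x i ≟ᵇ true) ¬full'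
... | i , missing = x , i , λ same → missing (trans (≡.sym same) (full i))

sum-b2n≤length : ∀ bs → sum (map b2n bs) ≤ length bs
sum-b2n≤length []           = z≤n
sum-b2n≤length (true  ∷ bs) = s≤s (sum-b2n≤length bs)
sum-b2n≤length (false ∷ bs) = m≤n⇒m≤1+n (sum-b2n≤length bs)

sum-b2n≡length⇒all-true : ∀ bs → sum (map b2n bs) ≡ length bs → All (_≡ true) bs
sum-b2n≡length⇒all-true []           _  = []
sum-b2n≡length⇒all-true (true  ∷ bs) eq = refl ∷ sum-b2n≡length⇒all-true bs (cong pred eq)
sum-b2n≡length⇒all-true (false ∷ bs) eq
  with () ← <-irrefl refl (subst (_≤ length bs) eq (sum-b2n≤length bs))

deg≡n⇒Full : ∀ {n} (G : Subgraph n) {x} → deg G x ≡ n → Full G x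
deg≡n⇒Full {n} G {x} deg≡n i = All.lookup (map⁻ all-true) (∈-allFin i)
  where
  open ≡-Reasoning
  all-true : All (_≡ true) (map (edge G x) (allFin n))
  all-true = sum-b2n≡length⇒all-true _ (begin
    sum (map b2n (map (edge G x) (allFin n))) ≡⟨ cong sum (map-∘ (allFin n)) ⟨
    deg G x                                   ≡⟨ deg≡n ⟩
    n                                         ≡⟨ length-tabulate (λ i → i) ⟨
    length (allFin n)                         ≡⟨ length-map (edge G x) (allFin n) ⟨
    length (map (edge G x) (allFin n))        ∎)

injective⇒no-miss : ∀ {m} {f : Fin (suc m) → Fin (suc m)} → Injective _≡_ _≡_ f → ∀ j → ¬ (∀ q → j ≢ f q)
injective⇒no-miss {m} f-inj j avoids
  with i , i′ , i<i′ , same ← pigeonhole (n<1+n m) (λ q → punchOut (avoids q))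
  = <-irreflᶠ (f-inj (punchOut-injective (avoids i) (avoids i′) same)) i<i′

injective⇒surjective : ∀ {n} {f : Fin n → Fin n} → Injective _≡_ _≡_ f → ∀ j → ∃ λ q → f q ≡ j
injective⇒surjective {suc m} {f} f-inj j with any? (λ q → f q ≟ᶠ j)
... | yes hit  = hit
... | no  miss = ⊥-elim (injective⇒no-miss f-inj j (λ q j≡fq → miss (q , ≡.sym j≡fq)))

-- n distinct neighbours of u use n distinct directions, i.e. all of them.
injective-neighbours⇒Full : ∀ {n} (G : Subgraph n) {u} (f : Fin n → V n) →
  Injective _≡_ _≡_ f → (∀ q → Adj G u (f q)) → Full G u
injective-neighbours⇒Full G {u} f f-inj adj j =
  let q , dq≡j = injective⇒surjective direction-inj j
  in subst (λ i → edge G u i ≡ true) dq≡j (proj₂ (proj₂ (adj q)))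
  where
  direction : Fin _ → Fin _
  direction q = proj₁ (adj q)
  direction-inj : Injective _≡_ _≡_ direction
  direction-inj {q} {q′} same with adj q | adj q′
  ... | _ , fq , _ | _ , fq′ , _ = f-inj (trans fq (trans (cong (flipAt u) same) (≡.sym fq′)))

cons-injective : ∀ {n} {A : Set} {x : A} {xs : Fin n → A} →
  (∀ p → xs p ≢ x) → Injective _≡_ _≡_ xs → Injective _≡_ _≡_ (x Vector.∷ xs)
cons-injective fresh xs-inj {zero}  {zero}   _  = refl
cons-injective fresh xs-inj {zero}  {suc p′} eq with () ← fresh p′ (≡.sym eq)
cons-injective fresh xs-inj {suc p} {zero}   eq with () ← fresh p eq
cons-injective fresh xs-inj {suc p} {suc p′} eq = cong suc (xs-inj eq)

FullIndependent⇒DoubleStarFree : ∀ {m} (G : Subgraph (suc m)) → FullIndependent G → DoubleStarFree G m m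
FullIndependent⇒DoubleStarFree G independent ds with DoubleStarIn.uv ds
... | i , refl , _ = independent u i full-u full-v
  where
  open DoubleStarIn ds
  full-u : Full G u
  full-u = injective-neighbours⇒Full G (v Vector.∷ a) (cons-injective a≢v a-inj)
    λ { zero → uv ; (suc p) → ua p }
  full-v : Full G v
  full-v = injective-neighbours⇒Full G (u Vector.∷ b) (cons-injective b≢u b-inj)
    λ { zero → Adj-sym G uv ; (suc q) → vb q }

join : ∀ {n} → Subgraph n → Subgraph n → Subgraph (suc n)
join {n} A B = record { edge = edge′ ; sym = sym′ }
  where
  edge′ : V (suc n) → Fin (suc n) → Bool
  edge′ (_     ∷ x) zero    = true
  edge′ (false ∷ x) (suc i) = edge A x i
  edge′ (true  ∷ x) (suc i) = edge B x i
  sym′ : ∀ x i → edge′ (flipAt x i) i ≡ edge′ x i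
  sym′ (false ∷ x) zero    = refl
  sym′ (true  ∷ x) zero    = refl
  sym′ (false ∷ x) (suc i) = Subgraph.sym A x i
  sym′ (true  ∷ x) (suc i) = Subgraph.sym B x i

join-FullIndependent : ∀ {n} {A B : Subgraph n} →
  FullIndependent A → FullIndependent B → FullDisjoint A B → FullIndependent (join A B)
join-FullIndependent indA indB disj (false ∷ x) zero    f f′ = disj x (f ∘ suc) (f′ ∘ suc)
join-FullIndependent indA indB disj (true  ∷ x) zero    f f′ = disj x (f′ ∘ suc) (f ∘ suc)
join-FullIndependent indA indB disj (false ∷ x) (suc i) f f′ = indA x i (f ∘ suc) (f′ ∘ suc)
join-FullIndependent indA indB disj (true  ∷ x) (suc i) f f′ = indB x i (f ∘ suc) (f′ ∘ suc)

join-FullDisjoint : ∀ {n} {A B : Subgraph n} → FullDisjoint A B → FullDisjoint (join A B) (join B A)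
join-FullDisjoint disj (false ∷ x) f f′ = disj x (f ∘ suc) (f′ ∘ suc)
join-FullDisjoint disj (true  ∷ x) f f′ = disj x (f′ ∘ suc) (f ∘ suc)

join-Full : ∀ {n} {A B : Subgraph n} {x} → Full A x → Full (join A B) (false ∷ x)
join-Full f zero    = refl
join-Full f (suc i) = f i

sum-concatMap : ∀ {A : Set} (f : A → List ℕ) xs → sum (concatMap f xs) ≡ sum (map (sum ∘ f) xs)
sum-concatMap f []       = refl
sum-concatMap f (x ∷ xs) = trans (sum-++ (f x) (concatMap f xs)) (cong (sum (f x) +_) (sum-concatMap f xs))

sum-map-suc : ∀ {A : Set} (g : A → ℕ) xs → sum (map (suc ∘ g) xs) ≡ length xs + sum (map g xs)
sum-map-suc g []       = refl
sum-map-suc g (x ∷ xs) = cong suc (begin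
  g x + sum (map (suc ∘ g) xs)      ≡⟨ cong (g x +_) (sum-map-suc g xs) ⟩
  g x + (length xs + sum (map g xs)) ≡⟨ +-assoc (g x) _ _ ⟨
  g x + length xs + sum (map g xs)   ≡⟨ cong (_+ sum (map g xs)) (+-comm (g x) (length xs)) ⟩
  length xs + g x + sum (map g xs)   ≡⟨ +-assoc (length xs) _ _ ⟩
  length xs + (g x + sum (map g xs)) ∎)
  where open ≡-Reasoning

length-allV : ∀ n → length (allV n) ≡ 2 ^ n
length-allV zero    = refl
length-allV (suc n) = begin
  length (map (false ∷_) (allV n) ++ map (true ∷_) (allV n))
    ≡⟨ length-++ (map (false ∷_) (allV n)) ⟩
  length (map (false ∷_) (allV n)) + length (map (true ∷_) (allV n))
    ≡⟨ cong₂ _+_ (trans (length-map _ (allV n)) (length-allV n)) (trans (length-map _ (allV n)) (length-allV n)) ⟩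
  2 ^ n + 2 ^ n
    ≡⟨ cong (2 ^ n +_) (+-identityʳ (2 ^ n)) ⟨
  2 ^ suc n ∎
  where open ≡-Reasoning

sum-allV-suc : ∀ {n} (f : V (suc n) → ℕ) →
  sum (map f (allV (suc n))) ≡ sum (map (f ∘ (false ∷_)) (allV n)) + sum (map (f ∘ (true ∷_)) (allV n))
sum-allV-suc {n} f = begin
  sum (map f (map (false ∷_) (allV n) ++ map (true ∷_) (allV n)))
    ≡⟨ cong sum (map-++ f (map (false ∷_) (allV n)) _) ⟩
  sum (map f (map (false ∷_) (allV n)) ++ map f (map (true ∷_) (allV n)))
    ≡⟨ sum-++ (map f (map (false ∷_) (allV n))) _ ⟩
  sum (map f (map (false ∷_) (allV n))) + sum (map f (map (true ∷_) (allV n)))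
    ≡⟨ cong₂ _+_ (cong sum (map-∘ (allV n))) (cong sum (map-∘ (allV n))) ⟨
  sum (map (f ∘ (false ∷_)) (allV n)) + sum (map (f ∘ (true ∷_)) (allV n)) ∎
  where open ≡-Reasoning

edgesCountedAt : ∀ {n} → Subgraph n → V n → ℕ
edgesCountedAt {n} G x = sum (map (λ i → b2n (not (lookup x i) ∧ edge G x i)) (allFin n))

edgeCount≡sum-edgesCountedAt : ∀ {n} (G : Subgraph n) → edgeCount G ≡ sum (map (edgesCountedAt G) (allV n))
edgeCount≡sum-edgesCountedAt {n} G = sum-concatMap _ (allV n)

sum-map-allFin-suc : ∀ {n} (f : Fin (suc n) → ℕ) → sum (map f (allFin (suc n))) ≡ f zero + sum (map (f ∘ suc) (allFin n))
sum-map-allFin-suc {n} f =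
  cong (λ xs → f zero + sum xs) (trans (map-tabulate suc f) (≡.sym (map-tabulate (λ i → i) (f ∘ suc))))

join-edgesCountedAt-false : ∀ {n} (A B : Subgraph n) x → edgesCountedAt (join A B) (false ∷ x) ≡ suc (edgesCountedAt A x)
join-edgesCountedAt-false A B x = sum-map-allFin-suc (λ i → b2n (not (lookup (false ∷ x) i) ∧ edge (join A B) (false ∷ x) i))

join-edgesCountedAt-true : ∀ {n} (A B : Subgraph n) x → edgesCountedAt (join A B) (true ∷ x) ≡ edgesCountedAt B x
join-edgesCountedAt-true A B x = sum-map-allFin-suc (λ i → b2n (not (lookup (true ∷ x) i) ∧ edge (join A B) (true ∷ x) i))

edgeCount-join : ∀ {n} (A B : Subgraph n) → edgeCount (join A B) ≡ 2 ^ n + edgeCount A + edgeCount B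
edgeCount-join {n} A B = begin
  edgeCount (join A B)
    ≡⟨ edgeCount≡sum-edgesCountedAt (join A B) ⟩
  sum (map (edgesCountedAt (join A B)) (allV (suc n)))
    ≡⟨ sum-allV-suc (edgesCountedAt (join A B)) ⟩
  sum (map (edgesCountedAt (join A B) ∘ (false ∷_)) (allV n)) + sum (map (edgesCountedAt (join A B) ∘ (true ∷_)) (allV n))
    ≡⟨ cong₂ _+_ (cong sum (map-cong (join-edgesCountedAt-false A B) (allV n))) (cong sum (map-cong (join-edgesCountedAt-true A B) (allV n))) ⟩
  sum (map (suc ∘ edgesCountedAt A) (allV n)) + sum (map (edgesCountedAt B) (allV n))
    ≡⟨ cong (_+ _) (sum-map-suc (edgesCountedAt A) (allV n)) ⟩
  length (allV n) + sum (map (edgesCountedAt A) (allV n)) + sum (map (edgesCountedAt B) (allV n))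
    ≡⟨ cong₂ (λ l a → l + a + sum (map (edgesCountedAt B) (allV n))) (length-allV n) (≡.sym (edgeCount≡sum-edgesCountedAt A)) ⟩
  2 ^ n + edgeCount A + sum (map (edgesCountedAt B) (allV n))
    ≡⟨ cong (2 ^ n + edgeCount A +_) (edgeCount≡sum-edgesCountedAt B) ⟨
  2 ^ n + edgeCount A + edgeCount B ∎
  where open ≡-Reasoning

_⇒ᵇ_ : Bool → Bool → Bool
x ⇒ᵇ y = not x ∨ y

-- base p is the translate by (0,0,p) of the graph missing the edge in
-- direction i at x exactly when x_{i+1} = 1 and x_{i+2} = 0.
base : Bool → Subgraph 3
base p = record { edge = edge′ ; sym = sym′ }
  where
  edge′ : V 3 → Fin 3 → Bool
  edge′ (a ∷ b ∷ c ∷ []) zero             = b ⇒ᵇ (p xor c)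
  edge′ (a ∷ b ∷ c ∷ []) (suc zero)       = (p xor c) ⇒ᵇ a
  edge′ (a ∷ b ∷ c ∷ []) (suc (suc zero)) = a ⇒ᵇ b
  sym′ : ∀ x i → edge′ (flipAt x i) i ≡ edge′ x i
  sym′ (a ∷ b ∷ c ∷ []) zero             = refl
  sym′ (a ∷ b ∷ c ∷ []) (suc zero)       = refl
  sym′ (a ∷ b ∷ c ∷ []) (suc (suc zero)) = refl

⇒ᵇ-cycle : ∀ a b c → b ⇒ᵇ c ≡ true → c ⇒ᵇ a ≡ true → a ⇒ᵇ b ≡ true → a ≡ b × b ≡ c
⇒ᵇ-cycle false false false _  _  _  = refl , refl
⇒ᵇ-cycle true  true  true  _  _  _  = refl , refl
⇒ᵇ-cycle false false true  _  () _
⇒ᵇ-cycle false true  false () _  _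
⇒ᵇ-cycle false true  true  _  () _
⇒ᵇ-cycle true  false false _  _  ()
⇒ᵇ-cycle true  false true  _  _  ()
⇒ᵇ-cycle true  true  false () _  _

base-Full : ∀ p a b c → Full (base p) (a ∷ b ∷ c ∷ []) → a ≡ b × b ≡ p xor c
base-Full p a b c full = ⇒ᵇ-cycle a b (p xor c) (full zero) (full (suc zero)) (full (suc (suc zero)))

base-FullIndependent : ∀ p → FullIndependent (base p)
base-FullIndependent p (a ∷ b ∷ c ∷ []) i full full′ with base-Full p a b c full | i
... | a≡b , _ | zero with ¬a≡b , _ ← base-Full p (not a) b c full′
  = not-¬ refl (trans a≡b (≡.sym ¬a≡b))
... | a≡b , _ | suc zero with a≡¬b , _ ← base-Full p a (not b) c full′
  = not-¬ a≡b a≡¬b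
... | _ , b≡pc | suc (suc zero) with _ , b≡p¬c ← base-Full p a b (not c) full′
  = not-¬ b≡pc (trans b≡p¬c (≡.sym (not-distribʳ-xor p c)))

base-FullDisjoint : ∀ p → FullDisjoint (base p) (base (not p))
base-FullDisjoint p (a ∷ b ∷ c ∷ []) full full′
  with _ , b≡pc ← base-Full p a b c full | _ , b≡¬pc ← base-Full (not p) a b c full′
  = not-¬ b≡pc (trans b≡¬pc (≡.sym (not-distribˡ-xor p c)))

G : (k : ℕ) → Bool → Subgraph (3 + k)
G zero    p = base p
G (suc k) p = join (G k p) (G k (not p))

G-FullDisjoint : ∀ k p → FullDisjoint (G k p) (G k (not p))
G-FullDisjoint zero    p     = base-FullDisjoint p
G-FullDisjoint (suc k) false = join-FullDisjoint (G-FullDisjoint k false)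
G-FullDisjoint (suc k) true  = join-FullDisjoint (G-FullDisjoint k true)

G-FullIndependent : ∀ k p → FullIndependent (G k p)
G-FullIndependent zero    p = base-FullIndependent p
G-FullIndependent (suc k) p =
  join-FullIndependent (G-FullIndependent k p) (G-FullIndependent k (not p)) (G-FullDisjoint k p)

G-Full-origin : ∀ k → Full (G k false) (replicate (3 + k) false)
G-Full-origin zero    zero             = refl
G-Full-origin zero    (suc zero)       = refl
G-Full-origin zero    (suc (suc zero)) = refl
G-Full-origin (suc k) = join-Full (G-Full-origin k)

G-edgeCount : ∀ k p → edgeCount (G k p) ≡ 2 ^ k * (9 + 4 * k)
G-edgeCount zero    false = refl
G-edgeCount zero    true  = refl
G-edgeCount (suc k) p = begin
  edgeCount (G (suc k) p)
    ≡⟨ edgeCount-join (G k p) (G k (not p)) ⟩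
  2 ^ (3 + k) + edgeCount (G k p) + edgeCount (G k (not p))
    ≡⟨ cong₂ (λ e e′ → 2 ^ (3 + k) + e + e′) (G-edgeCount k p) (G-edgeCount k (not p)) ⟩
  2 ^ (3 + k) + 2 ^ k * (9 + 4 * k) + 2 ^ k * (9 + 4 * k)
    ≡⟨ doubling (2 ^ k) k ⟩
  2 ^ suc k * (9 + 4 * suc k) ∎
  where
  open ≡-Reasoning
  doubling : ∀ a k → 2 * (2 * (2 * a)) + a * (9 + 4 * k) + a * (9 + 4 * k) ≡ 2 * a * (9 + 4 * suc k)
  doubling = solve-∀

G-edgeCount-4n∸3 : ∀ k p → edgeCount (G k p) ≡ 2 ^ k * (4 * (3 + k) ∸ 3)
G-edgeCount-4n∸3 k p = begin
  edgeCount (G k p)            ≡⟨ G-edgeCount k p ⟩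
  2 ^ k * (9 + 4 * k)          ≡⟨ cong (2 ^ k *_) (m+n∸m≡n 3 (9 + 4 * k)) ⟨
  2 ^ k * (3 + (9 + 4 * k) ∸ 3) ≡⟨ cong (λ m → 2 ^ k * (m ∸ 3)) (four-times k) ⟨
  2 ^ k * (4 * (3 + k) ∸ 3)     ∎
  where
  open ≡-Reasoning
  four-times : ∀ k → 4 * (3 + k) ≡ 3 + (9 + 4 * k)
  four-times = solve-∀

claim2p2 : (n : ℕ) → 3 ≤ n →
    Σ (Subgraph n) λ G → Σ (Subgraph n) λ G' →
      Distinct G G'
      × DoubleStarFree G (n ∸ 1) (n ∸ 1)
      × DoubleStarFree G' (n ∸ 1) (n ∸ 1)
      × edgeCount G ≡ 2 ^ (n ∸ 3) * (4 * n ∸ 3)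
      × edgeCount G' ≡ 2 ^ (n ∸ 3) * (4 * n ∸ 3)
      × (∀ (x : V n) → ¬ (deg G x ≡ n × deg G' x ≡ n))
claim2p2 (suc (suc (suc k))) (s≤s (s≤s (s≤s z≤n))) =
  G k false , G k true ,
  Full⇒Distinct (G k false) (G k true) (G-Full-origin k) (G-FullDisjoint k false _ (G-Full-origin k)) ,
  FullIndependent⇒DoubleStarFree (G k false) (G-FullIndependent k false) ,
  FullIndependent⇒DoubleStarFree (G k true) (G-FullIndependent k true) ,
  G-edgeCount-4n∸3 k false ,
  G-edgeCount-4n∸3 k true ,
  λ x (deg≡n , deg′≡n) → G-FullDisjoint k false x (deg≡n⇒Full (G k false) deg≡n) (deg≡n⇒Full (G k true) deg′≡n)
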